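{- Let $n,k,m$ be positive integers with $n\ge km$. Let $\mathcal{F}=\{F_1,\ldots,F_m\}$ be a saturated family of $k$-graphs on the same vertex set $[n]$. Then for each $v\in[n]$ and each $i\in[m]$, either $d_{F_i}(v)\le \binom{n-1}{k-1}-\binom{n-1-k(m-1)}{k-1}$ or $d_{F_i}(v)=\binom{n-1}{k-1}$.
   Context: A $k$-graph is a hypergraph all of whose edges have size $k$. For a hypergraph $H$ and vertex $v$, $d_H(v)$ is the number of edges of $H$ containing $v$. For a family $\mathcal{F}=\{F_1,\ldots,F_m\}$ of hypergraphs on a common vertex set, a rainbow matching is a set of $m$ pairwise disjoint edges $e_1,\ldots,e_m$ with $e_i\in F_i$. The family $\mathcal{F}$ of $k$-graphs on $[n]$ is saturated if $\mathcal{F}$ does not admit a rainbow matching, but for every $F\in\mathcal{F}$ and every $k$-subset $e\notin F$ of $[n]$, the family $(\mathcal{F}\setminus\{F\})\cup\{F\cup\{e\}\}$ admits a rainbow matching. -}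

module Defs where

open import Data.Nat using (ℕ; zero; suc; _+_)
open import Data.Bool using (Bool; true; false; _∧_; _∨_; if_then_else_)
open import Data.Fin using (Fin)
open import Data.Fin.Subset using (Subset; ∣_∣; _∈_; _∩_; Empty)
open import Data.Fin.Subset.Properties using (_∈?_)
open import Data.List using (List; []; _∷_; _++_; map)
open import Data.Vec using (Vec; []; _∷_)
open import Data.Vec.Properties using (≡-dec)
open import Data.Product using (Σ; _×_)
open import Relation.Nullary using (¬_; Dec; yes; no; does)
open import Relation.Binary.PropositionalEquality using (_≡_; _≢_)
import Data.Bool.Properties as BP
import Data.Fin.Properties as FP

Hypergraph : ℕ → Set
Hypergraph n = Subset n → Bool

IsKGraph : {n : ℕ} → ℕ → Hypergraph n → Set
IsKGraph {n} k H = (e : Subset n) → H e ≡ true → ∣ e ∣ ≡ k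

allSubsets : (n : ℕ) → List (Subset n)
allSubsets zero = [] ∷ []
allSubsets (suc n) = map (true ∷_) (allSubsets n) ++ map (false ∷_) (allSubsets n)

countTrue : {A : Set} → (A → Bool) → List A → ℕ
countTrue p [] = 0
countTrue p (x ∷ xs) = (if p x then 1 else 0) + countTrue p xs

degree : {n : ℕ} → Hypergraph n → Fin n → ℕ
degree {n} H v = countTrue (λ e → H e ∧ does (v ∈? e)) (allSubsets n)

Disjoint : {n : ℕ} → Subset n → Subset n → Set
Disjoint p q = Empty (p ∩ q)

Family : ℕ → ℕ → Set
Family m n = Fin m → Hypergraph n

RainbowMatching : {m n : ℕ} → Family m n → (Fin m → Subset n) → Set
RainbowMatching {m} F e =
  ((i : Fin m) → F i (e i) ≡ true) ×
  ((i j : Fin m) → i ≢ j → Disjoint (e i) (e j))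

HasRainbowMatching : {m n : ℕ} → Family m n → Set
HasRainbowMatching {m} {n} F = Σ (Fin m → Subset n) (RainbowMatching F)

addEdge : {n : ℕ} → Hypergraph n → Subset n → Hypergraph n
addEdge H e f = H f ∨ does (≡-dec BP._≟_ f e)

replaceAdd : {m n : ℕ} → Family m n → Fin m → Subset n → Family m n
replaceAdd F i e j = if does (j FP.≟ i) then addEdge (F i) e else F j

Saturated : {m n : ℕ} → ℕ → Family m n → Set
Saturated {m} {n} k F =
  ¬ HasRainbowMatching F ×
  ((i : Fin m) (e : Subset n) → ∣ e ∣ ≡ k → F i e ≡ false →
     HasRainbowMatching (replaceAdd F i e))

-- Fix v and i, and let K be the complete k-graph on [n]; d_{F_i}(v) ≤ d_K(v) = C(n-1,k-1).
-- If equality fails, some k-set e ∋ v is missing from F_i.  Adding e to F_i creates a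
-- rainbow matching, which must use e for F_i; its other m-1 edges cover a set U of at
-- most k(m-1) vertices, none of them v.  No k-set f ∋ v avoiding U lies in F_i, since
-- f could replace e in the matching.  So F_i misses at least C(n-1-|U|, k-1) of the
-- k-sets through v, which gives the bound.
module Submission where

open import Defs
open import Data.Bool using (Bool; true; false; _∧_; _∨_; if_then_else_)
open import Data.Bool.Properties as Bool using (∧-zeroʳ; ∧-identityʳ)
open import Data.Empty using (⊥; ⊥-elim)
open import Data.Fin using (Fin; zero; suc; punchIn; punchOut)
open import Data.Fin.Properties as Fin using (punchInᵢ≢i; punchIn-punchOut)
open import Data.Fin.Subset using (Subset; inside; outside; ∣_∣; _∈_; _∉_; _⊆_; _∪_; ∁; ⊤; ⋃)
open import Data.Fin.Subset.Properties
  using (_∈?_; _⊆?_; ∈⊤; ∉⊥; ∣⊥∣≡0; ∣p∣≤∣x∷p∣; ∣⊤∣≡n; ∣∁p∣≡n∸∣p∣;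
         x∈p∩q⁺; x∈p∩q⁻; x∈p∪q⁺; x∈p∪q⁻; x∈∁p⇒x∉p; x∉p⇒x∈∁p)
open import Data.List using (List; []; _∷_; _++_; map; length; tabulate)
open import Data.List.Properties using (length-tabulate)
open import Data.List.Relation.Unary.All using (All; []; _∷_)
import Data.List.Relation.Unary.All.Properties as Allₚ
open import Data.List.Relation.Unary.Any as Any using (Any)
import Data.List.Relation.Unary.Any.Properties as Anyₚ
open import Data.Nat using (ℕ; zero; suc; _+_; _*_; _∸_; _≤_; _<_; _≥_; _≤′_; ≤′-refl; ≤′-step;
                            NonZero; z≤n; s≤s; pred; >-nonZero)
open import Data.Nat.Combinatorics using (_C_; nCk+nC[k+1]≡[n+1]C[k+1])
open import Data.Nat.Properties
open import Data.Product using (_×_; _,_; proj₁; proj₂; ∃-syntax)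
open import Data.Sum using (_⊎_; inj₁; inj₂)
import Data.Sum as Sum
open import Data.Vec using ([]; _∷_; here; there)
open import Data.Vec.Functional using (updateAt)
open import Data.Vec.Functional.Properties using (updateAt-updates; updateAt-minimal)
open import Data.Vec.Properties using (≡-dec)
open import Function using (_∘_; const)
open import Relation.Nullary using (¬_; Dec; yes; no; does; _×-dec_)
open import Relation.Nullary.Decidable using (dec-true; dec-false)
open import Relation.Binary.PropositionalEquality

∧-true⁻ : ∀ {a b} → a ∧ b ≡ true → a ≡ true × b ≡ true
∧-true⁻ {true} {true} refl = refl , refl

∧-true⁺ : ∀ {a b} → a ≡ true → b ≡ true → a ∧ b ≡ true
∧-true⁺ refl refl = refl

dec-true⁻¹ : ∀ {P : Set} (p? : Dec P) → does p? ≡ true → P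
dec-true⁻¹ (yes p) _ = p

module _ {A : Set} where

  countTrue-++ : ∀ p (xs ys : List A) → countTrue p (xs ++ ys) ≡ countTrue p xs + countTrue p ys
  countTrue-++ p [] ys = refl
  countTrue-++ p (x ∷ xs) ys =
    trans (cong (_ +_) (countTrue-++ p xs ys)) (sym (+-assoc (if p x then 1 else 0) _ _))

  countTrue-cong : ∀ {p q : A → Bool} → (∀ x → p x ≡ q x) → ∀ xs → countTrue p xs ≡ countTrue q xs
  countTrue-cong p≗q [] = refl
  countTrue-cong p≗q (x ∷ xs) rewrite p≗q x = cong (_ +_) (countTrue-cong p≗q xs)

  countTrue-false : ∀ (p : A → Bool) → (∀ x → p x ≡ false) → ∀ xs → countTrue p xs ≡ 0
  countTrue-false p p≡false [] = refl
  countTrue-false p p≡false (x ∷ xs) rewrite p≡false x = countTrue-false p p≡false xs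

  countTrue-+-≤ : ∀ {p q r : A → Bool} →
    (∀ x → p x ≡ true → r x ≡ true) → (∀ x → q x ≡ true → r x ≡ true) →
    (∀ x → p x ≡ true → q x ≡ true → ⊥) →
    ∀ xs → countTrue p xs + countTrue q xs ≤ countTrue r xs
  countTrue-+-≤ p⇒r q⇒r p∩q≡∅ [] = z≤n
  countTrue-+-≤ {p} {q} {r} p⇒r q⇒r p∩q≡∅ (x ∷ xs)
    with ih ← countTrue-+-≤ p⇒r q⇒r p∩q≡∅ xs | p x in px | q x in qx | r x in rx
  ... | true  | true  | _     = ⊥-elim (p∩q≡∅ x px qx)
  ... | true  | false | true  = s≤s ih
  ... | false | true  | true  = ≤-trans (≤-reflexive (+-suc (countTrue p xs) (countTrue q xs))) (s≤s ih)
  ... | false | false | true  = m≤n⇒m≤1+n ih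
  ... | false | false | false = ih
  ... | true  | _     | false with () ← trans (sym (p⇒r x px)) rx
  ... | false | true  | false with () ← trans (sym (q⇒r x qx)) rx

  countTrue-mono : ∀ {p q : A → Bool} → (∀ x → p x ≡ true → q x ≡ true) →
    ∀ xs → countTrue p xs ≤ countTrue q xs
  countTrue-mono {p} p⇒q xs =
    subst (_≤ _) (trans (cong (countTrue p xs +_) (countTrue-false (const false) (λ _ → refl) xs)) (+-identityʳ _))
      (countTrue-+-≤ p⇒q (λ _ ()) (λ _ _ ()) xs)

  countTrue-≤-or-counterexample : ∀ (p q : A → Bool) xs →
    countTrue p xs ≤ countTrue q xs ⊎ ∃[ x ] p x ≡ true × q x ≡ false
  countTrue-≤-or-counterexample p q [] = inj₁ z≤n
  countTrue-≤-or-counterexample p q (x ∷ xs)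
    with ih ← countTrue-≤-or-counterexample p q xs | p x in px | q x in qx
  ... | true  | false = inj₂ (x , px , qx)
  ... | true  | true  = Sum.map₁ s≤s ih
  ... | false | true  = Sum.map₁ m≤n⇒m≤1+n ih
  ... | false | false = ih

countTrue-map : ∀ {A B : Set} (p : B → Bool) (f : A → B) xs →
  countTrue p (map f xs) ≡ countTrue (p ∘ f) xs
countTrue-map p f [] = refl
countTrue-map p f (x ∷ xs) = cong (_ +_) (countTrue-map p f xs)

countTrue-allSubsets-suc : ∀ {n} (p : Subset (suc n) → Bool) →
  countTrue p (allSubsets (suc n)) ≡
    countTrue (p ∘ (inside ∷_)) (allSubsets n) + countTrue (p ∘ (outside ∷_)) (allSubsets n)
countTrue-allSubsets-suc {n} p =
  trans (countTrue-++ p (map (inside ∷_) (allSubsets n)) _)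
        (cong₂ _+_ (countTrue-map p _ (allSubsets n)) (countTrue-map p _ (allSubsets n)))

nCk≤[1+n]Ck : ∀ n k → n C k ≤ suc n C k
nCk≤[1+n]Ck n zero = ≤-refl
nCk≤[1+n]Ck n (suc k) = subst (n C suc k ≤_) (nCk+nC[k+1]≡[n+1]C[k+1] n k) (m≤n+m _ _)

C-monoˡ-≤ : ∀ {m n} k → m ≤ n → m C k ≤ n C k
C-monoˡ-≤ k = mono ∘ ≤⇒≤′
  where
  mono : ∀ {m n} → m ≤′ n → m C k ≤ n C k
  mono ≤′-refl = ≤-refl
  mono (≤′-step m≤′n) = ≤-trans (mono m≤′n) (nCk≤[1+n]Ck _ k)

x∈p⇒0<∣p∣ : ∀ {n} {x : Fin n} {p : Subset n} → x ∈ p → 0 < ∣ p ∣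
x∈p⇒0<∣p∣ here = s≤s z≤n
x∈p⇒0<∣p∣ {p = inside ∷ p} (there _) = s≤s z≤n
x∈p⇒0<∣p∣ {p = outside ∷ p} (there x∈p) = x∈p⇒0<∣p∣ x∈p

∣p∪q∣≤∣p∣+∣q∣ : ∀ {n} (p q : Subset n) → ∣ p ∪ q ∣ ≤ ∣ p ∣ + ∣ q ∣
∣p∪q∣≤∣p∣+∣q∣ [] [] = z≤n
∣p∪q∣≤∣p∣+∣q∣ (inside ∷ p) (y ∷ q) = s≤s (≤-trans (∣p∪q∣≤∣p∣+∣q∣ p q) (+-monoʳ-≤ ∣ p ∣ (∣p∣≤∣x∷p∣ y q)))
∣p∪q∣≤∣p∣+∣q∣ (outside ∷ p) (inside ∷ q) =
  ≤-trans (s≤s (∣p∪q∣≤∣p∣+∣q∣ p q)) (≤-reflexive (sym (+-suc ∣ p ∣ ∣ q ∣)))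
∣p∪q∣≤∣p∣+∣q∣ (outside ∷ p) (outside ∷ q) = ∣p∪q∣≤∣p∣+∣q∣ p q

module _ {n : ℕ} where

  x∈⋃⁺ : ∀ {x} {ps : List (Subset n)} → Any (x ∈_) ps → x ∈ ⋃ ps
  x∈⋃⁺ (Any.here x∈p) = x∈p∪q⁺ (inj₁ x∈p)
  x∈⋃⁺ (Any.there x∈ps) = x∈p∪q⁺ (inj₂ (x∈⋃⁺ x∈ps))

  x∈⋃⁻ : ∀ {x} (ps : List (Subset n)) → x ∈ ⋃ ps → Any (x ∈_) ps
  x∈⋃⁻ [] x∈⊥ = ⊥-elim (∉⊥ x∈⊥)
  x∈⋃⁻ (p ∷ ps) x∈p∪⋃ps = Sum.[ Any.here , Any.there ∘ x∈⋃⁻ ps ]′ (x∈p∪q⁻ p (⋃ ps) x∈p∪⋃ps)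

  ∣⋃∣≤ : ∀ {k} {ps : List (Subset n)} → All (λ p → ∣ p ∣ ≤ k) ps → ∣ ⋃ ps ∣ ≤ length ps * k
  ∣⋃∣≤ [] = ≤-reflexive (∣⊥∣≡0 n)
  ∣⋃∣≤ {ps = p ∷ ps} (∣p∣≤k ∷ ∣ps∣≤k) = ≤-trans (∣p∪q∣≤∣p∣+∣q∣ p (⋃ ps)) (+-mono-≤ ∣p∣≤k (∣⋃∣≤ ∣ps∣≤k))

  _⊆ᴴ_ : Hypergraph n → Hypergraph n → Set
  H ⊆ᴴ H′ = ∀ e → H e ≡ true → H′ e ≡ true

  #edges : Hypergraph n → ℕ
  #edges H = countTrue H (allSubsets n)

  complete : Subset n → ℕ → Hypergraph n
  complete A k e = does (e ⊆? A ×-dec ∣ e ∣ ≟ k)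

  complete-mono : ∀ {A B} k → A ⊆ B → complete A k ⊆ᴴ complete B k
  complete-mono {A} {B} k A⊆B e e∈KA with e⊆A , ∣e∣≡k ← dec-true⁻¹ (e ⊆? A ×-dec ∣ e ∣ ≟ k) e∈KA =
    dec-true (e ⊆? B ×-dec ∣ e ∣ ≟ k) (A⊆B ∘ e⊆A , ∣e∣≡k)

  kGraph⊆complete : ∀ {k} {H : Hypergraph n} → IsKGraph k H → H ⊆ᴴ complete ⊤ k
  kGraph⊆complete {k} H-kgraph e e∈H = dec-true (e ⊆? ⊤ ×-dec ∣ e ∣ ≟ k) ((λ _ → ∈⊤) , H-kgraph e e∈H)

  through : ∀ {H H′ : Hypergraph n} v → H ⊆ᴴ H′ →
    ∀ e → H e ∧ does (v ∈? e) ≡ true → H′ e ∧ does (v ∈? e) ≡ true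
  through {H} v H⊆H′ e h with e∈H , v∈e ← ∧-true⁻ {H e} h = ∧-true⁺ (H⊆H′ e e∈H) v∈e

  module _ {H H′ : Hypergraph n} (v : Fin n) where

    degree-mono : H ⊆ᴴ H′ → degree H v ≤ degree H′ v
    degree-mono H⊆H′ = countTrue-mono (through v H⊆H′) (allSubsets n)

    degree-+-≤ : ∀ {G} → H ⊆ᴴ G → H′ ⊆ᴴ G → (∀ e → H e ≡ true → H′ e ≡ true → ⊥) →
      degree H v + degree H′ v ≤ degree G v
    degree-+-≤ H⊆G H′⊆G H∩H′≡∅ = countTrue-+-≤ (through v H⊆G) (through v H′⊆G)
      (λ e h h′ → H∩H′≡∅ e (proj₁ (∧-true⁻ {H e} h)) (proj₁ (∧-true⁻ {H′ e} h′)))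
      (allSubsets n)

    degree-≤-or-missing : degree H v ≤ degree H′ v ⊎ ∃[ e ] H e ≡ true × v ∈ e × H′ e ≡ false
    degree-≤-or-missing = Sum.map₂ missing
      (countTrue-≤-or-counterexample (λ e → H e ∧ does (v ∈? e)) (λ e → H′ e ∧ does (v ∈? e)) (allSubsets n))
      where
      missing : (∃[ e ] H e ∧ does (v ∈? e) ≡ true × H′ e ∧ does (v ∈? e) ≡ false) →
        ∃[ e ] H e ≡ true × v ∈ e × H′ e ≡ false
      missing (e , h , h′) with e∈H , v∈e ← ∧-true⁻ {H e} h =
        e , e∈H , dec-true⁻¹ (v ∈? e) v∈e ,
        trans (sym (∧-identityʳ (H′ e))) (subst (λ b → H′ e ∧ b ≡ false) v∈e h′)

  degree-complete-zero : ∀ (A : Subset n) v → degree (complete A 0) v ≡ 0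
  degree-complete-zero A v = countTrue-false _ no-empty-edge (allSubsets n)
    where
    no-empty-edge : ∀ e → complete A 0 e ∧ does (v ∈? e) ≡ false
    no-empty-edge e with v ∈? e
    ... | no _ = ∧-zeroʳ _
    ... | yes v∈e = trans (∧-identityʳ _)
      (trans (cong (does (e ⊆? A) ∧_) (dec-false (∣ e ∣ ≟ 0) (>⇒≢ (x∈p⇒0<∣p∣ v∈e)))) (∧-zeroʳ _))

#edges-complete : ∀ {n} (A : Subset n) k → #edges (complete A k) ≡ ∣ A ∣ C k
#edges-complete [] zero = refl
#edges-complete [] (suc k) = refl
#edges-complete {suc n} (inside ∷ A) zero = trans (countTrue-allSubsets-suc (complete (inside ∷ A) 0))
  (cong₂ _+_ (countTrue-false (complete (inside ∷ A) 0 ∘ (inside ∷_)) (λ e → ∧-zeroʳ (does (e ⊆? A)))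
                              (allSubsets n))
             (#edges-complete A zero))
#edges-complete (inside ∷ A) (suc k) = trans (countTrue-allSubsets-suc (complete (inside ∷ A) (suc k)))
  (trans (cong₂ _+_ (#edges-complete A k) (#edges-complete A (suc k))) (nCk+nC[k+1]≡[n+1]C[k+1] ∣ A ∣ k))
#edges-complete {suc n} (outside ∷ A) k = trans (countTrue-allSubsets-suc (complete (outside ∷ A) k))
  (cong₂ _+_ (countTrue-false (complete (outside ∷ A) k ∘ (inside ∷_)) (λ _ → refl) (allSubsets n))
             (#edges-complete A k))

degree-complete : ∀ {n} {A : Subset n} {v} → v ∈ A → ∀ k → degree (complete A (suc k)) v ≡ pred ∣ A ∣ C k
degree-complete {suc n} {inside ∷ A} here k = begin
  degree (complete (inside ∷ A) (suc k)) zero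
    ≡⟨ countTrue-allSubsets-suc (λ e → complete (inside ∷ A) (suc k) e ∧ does (zero ∈? e)) ⟩
  countTrue (λ e → complete A k e ∧ true) (allSubsets n) + countTrue outsider (allSubsets n)
    ≡⟨ cong₂ _+_ (countTrue-cong (∧-identityʳ ∘ complete A k) (allSubsets n))
                 (countTrue-false outsider (λ _ → ∧-zeroʳ _) (allSubsets n)) ⟩
  #edges (complete A k) + 0
    ≡⟨ +-identityʳ _ ⟩
  #edges (complete A k)
    ≡⟨ #edges-complete A k ⟩
  ∣ A ∣ C k ∎
  where
  open ≡-Reasoning
  outsider : Subset n → Bool
  outsider e = complete (inside ∷ A) (suc k) (outside ∷ e) ∧ false
degree-complete {A = inside ∷ A} {suc v} (there v∈A) zero =
  trans (countTrue-allSubsets-suc (λ e → complete (inside ∷ A) 1 e ∧ does (suc v ∈? e)))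
        (cong₂ _+_ (degree-complete-zero A v) (degree-complete v∈A zero))
degree-complete {A = inside ∷ A} {suc v} (there v∈A) (suc k) = begin
  degree (complete (inside ∷ A) (suc (suc k))) (suc v)
    ≡⟨ countTrue-allSubsets-suc (λ e → complete (inside ∷ A) (suc (suc k)) e ∧ does (suc v ∈? e)) ⟩
  degree (complete A (suc k)) v + degree (complete A (suc (suc k))) v
    ≡⟨ cong₂ _+_ (degree-complete v∈A k) (degree-complete v∈A (suc k)) ⟩
  pred ∣ A ∣ C k + pred ∣ A ∣ C suc k
    ≡⟨ nCk+nC[k+1]≡[n+1]C[k+1] (pred ∣ A ∣) k ⟩
  suc (pred ∣ A ∣) C suc k
    ≡⟨ cong (_C suc k) (suc-pred ∣ A ∣ {{>-nonZero (x∈p⇒0<∣p∣ v∈A)}}) ⟩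
  ∣ A ∣ C suc k ∎
  where open ≡-Reasoning
degree-complete {suc n} {outside ∷ A} {suc v} (there v∈A) k =
  trans (countTrue-allSubsets-suc (λ e → complete (outside ∷ A) (suc k) e ∧ does (suc v ∈? e)))
        (cong₂ _+_ (countTrue-false (λ e → complete (outside ∷ A) (suc k) (inside ∷ e) ∧ does (v ∈? e))
                                    (λ _ → refl) (allSubsets n))
                   (degree-complete v∈A k))

addEdge-new : ∀ {n} {H : Hypergraph n} {e f} → addEdge H e f ≡ true → H f ≡ false → f ≡ e
addEdge-new {H = H} {e} {f} f∈H+e f∉H =
  dec-true⁻¹ (≡-dec Bool._≟_ f e) (subst (λ b → b ∨ _ ≡ true) f∉H f∈H+e)

module _ {m n} (F : Family m n) where

  replaceAdd-≡ : ∀ {i} e → replaceAdd F i e i ≡ addEdge (F i) e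
  replaceAdd-≡ {i} e = cong (if_then addEdge (F i) e else F i) (dec-true (i Fin.≟ i) refl)

  replaceAdd-≢ : ∀ {i j} e → j ≢ i → replaceAdd F i e j ≡ F j
  replaceAdd-≢ {i} {j} e j≢i = cong (if_then addEdge (F i) e else F j) (dec-false (j Fin.≟ i) j≢i)

  rainbow-updateAt : ∀ (g : Fin m → Subset n) {i f} →
    (∀ j → j ≢ i → F j (g j) ≡ true) → (∀ j l → j ≢ l → Disjoint (g j) (g l)) →
    F i f ≡ true → (∀ j → j ≢ i → Disjoint f (g j)) →
    HasRainbowMatching F
  rainbow-updateAt g {i} {f} g-edge g-disjoint f∈Fi f-disjoint = h , h-edge , h-disjoint
    where
    h : Fin m → Subset n
    h = updateAt g i (const f)

    h≡f : h i ≡ f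
    h≡f = updateAt-updates i g

    h≡g : ∀ {j} → j ≢ i → h j ≡ g j
    h≡g {j} = updateAt-minimal j i g

    h-edge : ∀ j → F j (h j) ≡ true
    h-edge j with j Fin.≟ i
    ... | yes refl = subst (λ s → F i s ≡ true) (sym h≡f) f∈Fi
    ... | no j≢i = subst (λ s → F j s ≡ true) (sym (h≡g j≢i)) (g-edge j j≢i)

    disjoint-sym : ∀ {p q : Subset n} → Disjoint p q → Disjoint q p
    disjoint-sym p∩q≡∅ (x , x∈q∩p) with x∈q , x∈p ← x∈p∩q⁻ _ _ x∈q∩p = p∩q≡∅ (x , x∈p∩q⁺ (x∈p , x∈q))

    h-disjoint : ∀ j l → j ≢ l → Disjoint (h j) (h l)
    h-disjoint j l j≢l with j Fin.≟ i | l Fin.≟ i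
    ... | yes refl | yes refl = ⊥-elim (j≢l refl)
    ... | yes refl | no l≢i rewrite h≡f | h≡g l≢i = f-disjoint l l≢i
    ... | no j≢i | yes refl rewrite h≡f | h≡g j≢i = disjoint-sym (f-disjoint j j≢i)
    ... | no j≢i | no l≢i rewrite h≡g j≢i | h≡g l≢i = g-disjoint j l j≢l

module _ {n k m : ℕ} (F : Family (suc m) (suc n)) (F-kGraph : ∀ j → IsKGraph (suc k) (F j))
         (F-saturated : Saturated (suc k) F) (v : Fin (suc n)) (i : Fin (suc m)) where

  K : Hypergraph (suc n)
  K = complete ⊤ (suc k)

  degree-K : degree K v ≡ n C k
  degree-K = trans (degree-complete {A = ⊤} {v} ∈⊤ k) (cong (_C k) (∣⊤∣≡n n))

  no-rainbow : ¬ HasRainbowMatching F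
  no-rainbow = proj₁ F-saturated

  module MissingEdge (e : Subset (suc n)) (e∈K : K e ≡ true) (v∈e : v ∈ e) (e∉Fi : F i e ≡ false) where

    matching : HasRainbowMatching (replaceAdd F i e)
    matching = proj₂ F-saturated i e (proj₂ (dec-true⁻¹ (e ⊆? ⊤ ×-dec ∣ e ∣ ≟ suc k) e∈K)) e∉Fi

    g : Fin (suc m) → Subset (suc n)
    g = proj₁ matching

    g-disjoint : ∀ j l → j ≢ l → Disjoint (g j) (g l)
    g-disjoint = proj₂ (proj₂ matching)

    g-edge : ∀ j → j ≢ i → F j (g j) ≡ true
    g-edge j j≢i = subst (λ H → H (g j) ≡ true) (replaceAdd-≢ F e j≢i) (proj₁ (proj₂ matching) j)

    g-i≡e : g i ≡ e
    g-i≡e with F i (g i) in gi∈Fi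
    ... | true = ⊥-elim (no-rainbow
      (rainbow-updateAt F g g-edge g-disjoint gi∈Fi (λ j j≢i → g-disjoint i j (j≢i ∘ sym))))
    ... | false = addEdge-new {H = F i}
      (subst (λ H → H (g i) ≡ true) (replaceAdd-≡ F {i} e) (proj₁ (proj₂ matching) i)) gi∈Fi

    U : Subset (suc n)
    U = ⋃ (tabulate (g ∘ punchIn i))

    g⊆U : ∀ {j} → j ≢ i → g j ⊆ U
    g⊆U j≢i x∈gj = x∈⋃⁺ (Anyₚ.tabulate⁺ (punchOut (j≢i ∘ sym))
      (subst (λ l → _ ∈ g l) (sym (punchIn-punchOut (j≢i ∘ sym))) x∈gj))

    v∉U : v ∉ U
    v∉U v∈U with j , v∈gj ← Anyₚ.tabulate⁻ (x∈⋃⁻ (tabulate (g ∘ punchIn i)) v∈U) =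
      g-disjoint i (punchIn i j) (punchInᵢ≢i i j ∘ sym) (v , x∈p∩q⁺ (subst (v ∈_) (sym g-i≡e) v∈e , v∈gj))

    ∣U∣≤ : ∣ U ∣ ≤ suc k * m
    ∣U∣≤ = subst (∣ U ∣ ≤_) (trans (cong (_* suc k) (length-tabulate (g ∘ punchIn i))) (*-comm m (suc k)))
      (∣⋃∣≤ (Allₚ.tabulate⁺ (λ j → ≤-reflexive (F-kGraph _ _ (g-edge _ (punchInᵢ≢i i j))))))

    complete∁U-avoids-Fi : ∀ f → complete (∁ U) (suc k) f ≡ true → F i f ≡ true → ⊥
    complete∁U-avoids-Fi f f∈K∁U f∈Fi = no-rainbow (rainbow-updateAt F g g-edge g-disjoint f∈Fi f-disjoint)
      where
      f⊆∁U : f ⊆ ∁ U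
      f⊆∁U = proj₁ (dec-true⁻¹ (f ⊆? ∁ U ×-dec ∣ f ∣ ≟ suc k) f∈K∁U)

      f-disjoint : ∀ j → j ≢ i → Disjoint f (g j)
      f-disjoint j j≢i (x , x∈f∩gj) with x∈f , x∈gj ← x∈p∩q⁻ f (g j) x∈f∩gj =
        x∈∁p⇒x∉p (f⊆∁U x∈f) (g⊆U j≢i x∈gj)

    degree-complete∁U : degree (complete (∁ U) (suc k)) v ≡ (n ∸ ∣ U ∣) C k
    degree-complete∁U = trans (degree-complete (x∉p⇒x∈∁p v∉U) k)
      (cong (_C k) (trans (cong pred (∣∁p∣≡n∸∣p∣ U)) (pred[m∸n]≡m∸[1+n] (suc n) ∣ U ∣)))

    degree-bound : degree (F i) v ≤ n C k ∸ (n ∸ suc k * m) C k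
    degree-bound = begin
      degree (F i) v
        ≤⟨ m+n≤o⇒m≤o∸n _ (subst₂ (λ a b → degree (F i) v + a ≤ b) degree-complete∁U degree-K
             (degree-+-≤ v (kGraph⊆complete (F-kGraph i)) (complete-mono (suc k) (λ _ → ∈⊤))
                          (λ f f∈Fi f∈K∁U → complete∁U-avoids-Fi f f∈K∁U f∈Fi))) ⟩
      n C k ∸ (n ∸ ∣ U ∣) C k
        ≤⟨ ∸-monoʳ-≤ (n C k) (C-monoˡ-≤ k (∸-monoʳ-≤ n ∣U∣≤)) ⟩
      n C k ∸ (n ∸ suc k * m) C k ∎
      where open ≤-Reasoning

  degree-dichotomy : degree (F i) v ≤ n C k ∸ (n ∸ suc k * m) C k ⊎ degree (F i) v ≡ n C k
  degree-dichotomy with degree-≤-or-missing v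
  ... | inj₁ K≤Fi = inj₂ (trans (≤-antisym (degree-mono v (kGraph⊆complete (F-kGraph i))) K≤Fi) degree-K)
  ... | inj₂ (e , e∈K , v∈e , e∉Fi) = inj₁ (MissingEdge.degree-bound e e∈K v∈e e∉Fi)

lemma2p1 : (n k m : ℕ) → .{{NonZero n}} → .{{NonZero k}} → .{{NonZero m}} →
    n ≥ k * m →
    (F : Family m n) → ((i : Fin m) → IsKGraph k (F i)) →
    Saturated k F →
    (v : Fin n) (i : Fin m) →
    (degree (F i) v ≤ ((n ∸ 1) C (k ∸ 1)) ∸ ((n ∸ 1 ∸ k * (m ∸ 1)) C (k ∸ 1)))
    ⊎ (degree (F i) v ≡ (n ∸ 1) C (k ∸ 1))
lemma2p1 zero k m {{()}}
lemma2p1 (suc n) zero m {{_}} {{()}}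
lemma2p1 (suc n) (suc k) zero {{_}} {{_}} {{()}}
lemma2p1 (suc n) (suc k) (suc m) _ = degree-dichotomy
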